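{- For every integer $a\ge 2$, $$\beta_b(\overrightarrow{C}(2a;1,a)) = \beta_b(\overrightarrow{C}(2a;1,-a)) = \mathrm{diam}(\overrightarrow{C}(2a;1,a)) = a.$$
   Context: For integers $n\ge 3$ and $b_1,\dots,b_k$, the oriented circulant graph $\overrightarrow{C}(n;b_1,\dots,b_k)$ has vertex set $\{v_0,\dots,v_{n-1}\}$ and arc set $\{v_iv_{i+b_j} : 0\le i\le n-1,\ 1\le j\le k\}$, with subscripts taken modulo $n$ (negative $b_j$ allowed). For a vertex pair $u,v$, $d(u,v)$ is the length (number of arcs) of a shortest directed path from $u$ to $v$. The eccentricity of $v$ is $e(v)=\max_u d(v,u)$, and $\mathrm{diam}$ denotes the maximum eccentricity. An independent broadcast on an oriented graph $\overrightarrow{G}$ is a function $f:V(\overrightarrow{G})\to\{0,1,\dots,\mathrm{diam}(\overrightarrow{G})\}$ such that $f(v)\le e(v)$ for every vertex $v$, and $d(u,v)>f(u)$ for every two distinct vertices $u,v$ with $f(u)>0$ and $f(v)>0$. Its cost is $\sigma(f)=\sum_v f(v)$. The broadcast independence number $\beta_b(\overrightarrow{G})$ is the maximum cost of an independent broadcast on $\overrightarrow{G}$. -}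

module Defs where

open import Data.Nat using (ℕ; zero; suc; _≤_; _<_)
open import Data.Integer as ℤ using (ℤ; +_)
open import Data.Fin using (Fin; toℕ)
open import Data.List using (List; map; allFin)
open import Data.Nat.ListAction using (sum)
open import Data.List.Relation.Unary.Any using (Any)
open import Data.Product using (Σ; _×_; ∃; ∃-syntax)
open import Relation.Binary.PropositionalEquality using (_≡_; _≢_)

-- Oriented circulant graph C(n; b_1,...,b_k): vertex set Fin n (v_i ↦ i),
-- arc v_i → v_j iff j ≡ i + b_l (mod n) for some l.
CircArc : (n : ℕ) → List ℤ → Fin n → Fin n → Set
CircArc n bs u v =
  Any (λ b → ∃[ k ] (+ toℕ v ≡ (+ toℕ u ℤ.+ b) ℤ.+ k ℤ.* + n)) bs

Digraph : ℕ → Set₁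
Digraph n = Fin n → Fin n → Set

data Walk {n : ℕ} (G : Digraph n) : ℕ → Fin n → Fin n → Set where
  nil  : ∀ {u} → Walk G zero u u
  cons : ∀ {k u w v} → G u w → Walk G k w v → Walk G (suc k) u v

Dist : ∀ {n} → Digraph n → Fin n → Fin n → ℕ → Set
Dist G u v k = Walk G k u v × (∀ j → Walk G j u v → k ≤ j)

Ecc : ∀ {n} → Digraph n → Fin n → ℕ → Set
Ecc G v e = (∀ u → ∃[ k ] (Dist G v u k × k ≤ e)) × (∃[ u ] Dist G v u e)

Diam : ∀ {n} → Digraph n → ℕ → Set
Diam G D = (∀ v → ∃[ e ] (Ecc G v e × e ≤ D)) × (∃[ v ] Ecc G v D)

IsIndepBroadcast : ∀ {n} → Digraph n → (Fin n → ℕ) → Set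
IsIndepBroadcast G f =
  (∀ D → Diam G D → ∀ v → f v ≤ D) ×
  (∀ v e → Ecc G v e → f v ≤ e) ×
  (∀ u v → u ≢ v → 0 < f u → 0 < f v → ∀ k → Dist G u v k → f u < k)

cost : ∀ {n} → (Fin n → ℕ) → ℕ
cost {n} f = sum (map f (allFin n))

BroadcastIndepNumber : ∀ {n} → Digraph n → ℕ → Set
BroadcastIndepNumber {n} G m =
  (∃[ f ] (IsIndepBroadcast G f × cost f ≡ m)) ×
  (∀ f → IsIndepBroadcast G f → cost f ≤ m)

-- Write n = 2a. As −a ≡ a (mod n), both digraphs have exactly the arcs u → u + 1 and
-- u → u + a, and a walk with p arcs of the first kind and q of the second leads from u
-- to u + p + qa. Hence the distance from u to u + x (0 ≤ x < n) is
-- min(x, 1 + ((x + a) mod n)), which is at most a, with equality for x = 2a − 1: every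
-- vertex has eccentricity a, and broadcasting a from one vertex shows β ≥ a = diam.
-- Conversely, fold an independent broadcast f onto ℤ/a by H(r) = f(r) + f(r + a). As r
-- and r + a are at distance 1, at most one summand is positive; and a vertex r with
-- f(r) = k silences r + j and r + j + a for 0 < j < k, which it reaches by walks of
-- lengths j and j + 1. So the intervals [r, r + H(r)) are disjoint in ℤ/a, and
-- σ(f) = Σ H ≤ a.

module Submission where

open import Defs
open import Function using (_∘_; id)
open import Data.Product using (_×_; _,_; proj₁; proj₂; ∃-syntax)
open import Data.Sum using (_⊎_; inj₁; inj₂)
open import Relation.Nullary using (¬_; yes; no; contradiction)
open import Relation.Binary.PropositionalEquality
  using (_≡_; _≢_; refl; sym; trans; cong; cong₂; subst; subst₂; module ≡-Reasoning)
open import Data.Nat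
  using (ℕ; zero; suc; pred; _+_; _*_; _∸_; _⊓_; _≤_; _<_; _≤?_; _<?_;
         z≤n; s≤s; s≤s⁻¹; z<s; NonZero; >-nonZero⁻¹)
open import Data.Nat.Properties
open import Data.Nat.DivMod
  using (_%_; _/_; _mod_; m≡m%n+[m/n]*n; m%n<n; m%n≤m; m%n%n≡m%n; m<n⇒m%n≡m;
         [m+n]%n≡m%n; [m+kn]%n≡m%n; %-distribˡ-+)
open import Data.Integer as ℤ using (ℤ; +_; -_; -[1+_])
import Data.Integer.Properties as ℤ
open import Data.Integer.DivMod using (_/ℕ_; n%ℕd<d; a≡a%ℕn+[a/ℕn]*n)
open import Data.Integer.Tactic.RingSolver using (solve)
import Data.Nat.Tactic.RingSolver as ℕ-Ring
open import Data.Fin using (Fin; toℕ; fromℕ<) renaming (zero to fzero; suc to fsuc)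
open import Data.Fin.Properties using (toℕ-injective; toℕ-fromℕ<; toℕ<n)
open import Data.List using ([]; _∷_; [_]; _++_; map; tabulate; applyUpTo; allFin)
open import Data.List.Properties using (applyUpTo-∷ʳ; map-tabulate; tabulate-cong)
open import Data.List.Relation.Unary.Any using (here; there)
open import Data.Nat.ListAction using (sum)
open import Data.Nat.ListAction.Properties using (sum-++)
open import Algebra.Properties.CommutativeSemigroup +-commutativeSemigroup using (interchange)

-- Sums over initial segments of ℕ

tabulate-toℕ : ∀ {A : Set} m (g : ℕ → A) → tabulate (g ∘ toℕ {m}) ≡ applyUpTo g m
tabulate-toℕ zero    g = refl
tabulate-toℕ (suc m) g = cong (g 0 ∷_) (tabulate-toℕ m (g ∘ suc))

Periodic : ℕ → (ℕ → ℕ) → Set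
Periodic m g = ∀ r → g (r + m) ≡ g r

-- Equivalently: the intervals [r, r + g r) with g r > 0 are pairwise disjoint.
Gapped : (ℕ → ℕ) → Set
Gapped g = ∀ r j → 0 < j → j < g r → g (r + j) ≡ 0

module _ where
  open ≡-Reasoning

  sum-applyUpTo-suc : ∀ g m → sum (applyUpTo g (suc m)) ≡ sum (applyUpTo g m) + g m
  sum-applyUpTo-suc g m = begin
    sum (applyUpTo g (suc m))        ≡⟨ cong sum (applyUpTo-∷ʳ g m) ⟨
    sum (applyUpTo g m ++ [ g m ])   ≡⟨ sum-++ (applyUpTo g m) [ g m ] ⟩
    sum (applyUpTo g m) + (g m + 0)  ≡⟨ cong (_+_ (sum (applyUpTo g m))) (+-identityʳ (g m)) ⟩
    sum (applyUpTo g m) + g m        ∎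

  sum-applyUpTo-+ : ∀ g m k →
    sum (applyUpTo g (m + k)) ≡ sum (applyUpTo g m) + sum (applyUpTo (λ r → g (m + r)) k)
  sum-applyUpTo-+ g zero    k = refl
  sum-applyUpTo-+ g (suc m) k =
    trans (cong (_+_ (g 0)) (sum-applyUpTo-+ (g ∘ suc) m k)) (sym (+-assoc (g 0) _ _))

  sum-applyUpTo-distrib : ∀ g h m →
    sum (applyUpTo (λ r → g r + h r) m) ≡ sum (applyUpTo g m) + sum (applyUpTo h m)
  sum-applyUpTo-distrib g h zero    = refl
  sum-applyUpTo-distrib g h (suc m) =
    trans (cong (_+_ (g 0 + h 0)) (sum-applyUpTo-distrib (g ∘ suc) (h ∘ suc) m)) (interchange (g 0) (h 0) _ _)

  sum-applyUpTo-rotate : ∀ m {g} → Periodic m g → ∀ s →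
    sum (applyUpTo (λ r → g (s + r)) m) ≡ sum (applyUpTo g m)
  sum-applyUpTo-rotate m {g} per zero    = refl
  sum-applyUpTo-rotate m {g} per (suc s) =
    trans (sum-applyUpTo-rotate m (per ∘ suc) s) (+-cancelʳ-≡ (g 0) _ _ (begin
      sum (applyUpTo (g ∘ suc) m) + g 0 ≡⟨ +-comm _ (g 0) ⟩
      sum (applyUpTo g (suc m))         ≡⟨ sum-applyUpTo-suc g m ⟩
      sum (applyUpTo g m) + g m         ≡⟨ cong (_+_ (sum (applyUpTo g m))) (per 0) ⟩
      sum (applyUpTo g m) + g 0         ∎))

  sum-applyUpTo≡0⊎pos : ∀ m g → sum (applyUpTo g m) ≡ 0 ⊎ ∃[ s ] (s < m × 0 < g s)
  sum-applyUpTo≡0⊎pos zero    g = inj₁ refl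
  sum-applyUpTo≡0⊎pos (suc m) g with g 0 in g0 | sum-applyUpTo≡0⊎pos m (g ∘ suc)
  ... | suc _ | _                    = inj₂ (0 , z<s , subst (0 <_) (sym g0) z<s)
  ... | zero  | inj₁ sum≡0           = inj₁ sum≡0
  ... | zero  | inj₂ (s , s<m , pos) = inj₂ (suc s , s≤s s<m , pos)

module _ where
  open ≤-Reasoning

  private
    fits-suc : ∀ {m} {g : ℕ → ℕ} →
      (∀ r → r < suc m → r + g r ≤ suc m) → ∀ r → r < m → r + g (suc r) ≤ m
    fits-suc fits r r<m = s≤s⁻¹ (fits (suc r) (s≤s r<m))

  -- c counts the leading positions already covered by an interval that started earlier.
  sum-gapped-≤ : ∀ m {g c} → Gapped g → (∀ r → r < m → r + g r ≤ m) →
    c ≤ m → (∀ r → r < c → g r ≡ 0) → sum (applyUpTo g m) + c ≤ m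
  sum-gapped-≤ zero _ _ z≤n _ = z≤n
  sum-gapped-≤ (suc m) {g} {suc c} gap fits (s≤s c≤m) zeros = begin
    g 0 + S + suc c ≡⟨ cong (λ t → t + S + suc c) (zeros 0 z<s) ⟩
    S + suc c       ≡⟨ +-suc S c ⟩
    suc (S + c)     ≤⟨ s≤s (sum-gapped-≤ m (gap ∘ suc) (fits-suc fits) c≤m (λ r → zeros (suc r) ∘ s≤s)) ⟩
    suc m           ∎
    where
    S : ℕ
    S = sum (applyUpTo (g ∘ suc) m)
  sum-gapped-≤ (suc m) {g} {zero} gap fits z≤n _ with g 0 in g0
  ... | zero  = m≤n⇒m≤1+n (sum-gapped-≤ m (gap ∘ suc) (fits-suc fits) z≤n (λ _ ()))
  ... | suc k = begin
    suc k + S + 0 ≡⟨ +-identityʳ _ ⟩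
    suc (k + S)   ≡⟨ cong suc (+-comm k S) ⟩
    suc (S + k)   ≤⟨ s≤s (sum-gapped-≤ m (gap ∘ suc) (fits-suc fits) k≤m zeros) ⟩
    suc m         ∎
    where
    S : ℕ
    S = sum (applyUpTo (g ∘ suc) m)
    k≤m : k ≤ m
    k≤m = s≤s⁻¹ (subst (_≤ suc m) g0 (fits 0 z<s))
    zeros : ∀ r → r < k → g (suc r) ≡ 0
    zeros r r<k = gap 0 (suc r) z<s (subst (suc r <_) (sym g0) (s≤s r<k))

  sum-periodic-gapped-≤ : ∀ m {g} → Periodic m g → Gapped g → sum (applyUpTo g m) ≤ m
  sum-periodic-gapped-≤ m {g} per gap with sum-applyUpTo≡0⊎pos m g
  ... | inj₁ sum≡0 = subst (_≤ m) (sym sum≡0) z≤n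
  ... | inj₂ (s , s<m , 0<gs) = begin
    sum (applyUpTo g m)     ≡⟨ sum-applyUpTo-rotate m per s ⟨
    sum (applyUpTo h m)     ≡⟨ +-identityʳ _ ⟨
    sum (applyUpTo h m) + 0 ≤⟨ sum-gapped-≤ m gap-h fits z≤n (λ _ ()) ⟩
    m                       ∎
    where
    h : ℕ → ℕ
    h r = g (s + r)
    gap-h : Gapped h
    gap-h r j 0<j j<hr = trans (cong g (sym (+-assoc s r j))) (gap (s + r) j 0<j j<hr)
    -- An interval reaching past m would cover position m, where h m = g s > 0.
    fits : ∀ r → r < m → r + h r ≤ m
    fits r r<m with r + h r ≤? m
    ... | yes fit     = fit
    ... | no overflow = contradiction gs≡0 (n>0⇒n≢0 0<gs)
      where
      r+[m∸r]≡m : r + (m ∸ r) ≡ m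
      r+[m∸r]≡m = m+[n∸m]≡n (<⇒≤ r<m)
      gs≡0 : g s ≡ 0
      gs≡0 = trans (sym (per s)) (trans (cong h (sym r+[m∸r]≡m))
        (gap-h r (m ∸ r) (m<n⇒0<n∸m r<m)
          (+-cancelˡ-< r (m ∸ r) (h r) (subst (_< r + h r) (sym r+[m∸r]≡m) (≰⇒> overflow)))))

-- Congruences modulo m

-- A record rather than the Σ-type used by CircArc, so that its indices can be inferred.
infix 4 _≡_[mod_]
record _≡_[mod_] (x y m : ℤ) : Set where
  constructor congruent
  field
    quotient : ℤ
    equation : x ≡ y ℤ.+ quotient ℤ.* m

module Congruence (m : ℤ) where
  open ≡-Reasoning

  ≡⇒≡-mod : ∀ {x y} → x ≡ y → x ≡ y [mod m ]
  ≡⇒≡-mod {x} refl = congruent ℤ.0ℤ (solve (x ∷ m ∷ []))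

  mod-refl : ∀ {x} → x ≡ x [mod m ]
  mod-refl = ≡⇒≡-mod refl

  mod-sym : ∀ {x y} → x ≡ y [mod m ] → y ≡ x [mod m ]
  mod-sym {x} {y} (congruent k eq) = congruent (- k) (begin
    y                             ≡⟨ solve (y ∷ k ∷ m ∷ []) ⟩
    (y ℤ.+ k ℤ.* m) ℤ.+ - k ℤ.* m ≡⟨ cong (ℤ._+ - k ℤ.* m) eq ⟨
    x ℤ.+ - k ℤ.* m               ∎)

  mod-trans : ∀ {x y z} → x ≡ y [mod m ] → y ≡ z [mod m ] → x ≡ z [mod m ]
  mod-trans {x} {y} {z} (congruent k x≡) (congruent l y≡) = congruent (l ℤ.+ k) (begin
    x                             ≡⟨ x≡ ⟩
    y ℤ.+ k ℤ.* m                 ≡⟨ cong (ℤ._+ k ℤ.* m) y≡ ⟩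
    (z ℤ.+ l ℤ.* m) ℤ.+ k ℤ.* m   ≡⟨ solve (z ∷ l ∷ k ∷ m ∷ []) ⟩
    z ℤ.+ (l ℤ.+ k) ℤ.* m         ∎)

  mod-+ : ∀ {x y u v} → x ≡ y [mod m ] → u ≡ v [mod m ] → x ℤ.+ u ≡ y ℤ.+ v [mod m ]
  mod-+ {x} {y} {u} {v} (congruent k x≡) (congruent l u≡) = congruent (k ℤ.+ l) (begin
    x ℤ.+ u                                 ≡⟨ cong₂ ℤ._+_ x≡ u≡ ⟩
    (y ℤ.+ k ℤ.* m) ℤ.+ (v ℤ.+ l ℤ.* m)     ≡⟨ solve (y ∷ v ∷ k ∷ l ∷ m ∷ []) ⟩
    y ℤ.+ v ℤ.+ (k ℤ.+ l) ℤ.* m             ∎)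

  mod-*ˡ : ∀ z {x y} → x ≡ y [mod m ] → z ℤ.* x ≡ z ℤ.* y [mod m ]
  mod-*ˡ z {x} {y} (congruent k x≡) = congruent (z ℤ.* k) (begin
    z ℤ.* x                 ≡⟨ cong (z ℤ.*_) x≡ ⟩
    z ℤ.* (y ℤ.+ k ℤ.* m)   ≡⟨ solve (z ∷ y ∷ k ∷ m ∷ []) ⟩
    z ℤ.* y ℤ.+ z ℤ.* k ℤ.* m ∎)

  mod-cancelˡ : ∀ z {x y} → z ℤ.+ x ≡ z ℤ.+ y [mod m ] → x ≡ y [mod m ]
  mod-cancelˡ z {x} {y} (congruent k eq) = congruent k (begin
    x                             ≡⟨ solve (z ∷ x ∷ []) ⟩
    (z ℤ.+ x) ℤ.- z               ≡⟨ cong (ℤ._- z) eq ⟩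
    (z ℤ.+ y ℤ.+ k ℤ.* m) ℤ.- z   ≡⟨ solve (z ∷ y ∷ k ∷ m ∷ []) ⟩
    y ℤ.+ k ℤ.* m                 ∎)

  mod-compose : ∀ {x y z s d} →
    x ≡ y ℤ.+ s [mod m ] → z ≡ x ℤ.+ d [mod m ] → z ≡ y ℤ.+ (s ℤ.+ d) [mod m ]
  mod-compose {y = y} {s = s} {d} x≡ z≡ =
    mod-trans z≡ (mod-trans (mod-+ x≡ mod-refl) (≡⇒≡-mod (ℤ.+-assoc y s d)))

  mod-decompose : ∀ {x y z s d} →
    x ≡ y ℤ.+ s [mod m ] → z ≡ y ℤ.+ (s ℤ.+ d) [mod m ] → z ≡ x ℤ.+ d [mod m ]
  mod-decompose {y = y} {s = s} {d} x≡ z≡ =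
    mod-trans z≡ (mod-trans (≡⇒≡-mod (sym (ℤ.+-assoc y s d))) (mod-+ (mod-sym x≡) mod-refl))

-a≡a[mod2a] : ∀ a → - (+ a) ≡ + a [mod + (2 * a) ]
-a≡a[mod2a] a = congruent (- ℤ.1ℤ) (begin
  - (+ a)                          ≡⟨ ring (+ a) ⟩
  + a ℤ.+ - ℤ.1ℤ ℤ.* (+ 2 ℤ.* + a) ≡⟨ cong (λ t → + a ℤ.+ - ℤ.1ℤ ℤ.* t) (ℤ.pos-* 2 a) ⟨
  + a ℤ.+ - ℤ.1ℤ ℤ.* + (2 * a)     ∎)
  where
  open ≡-Reasoning
  ring : ∀ A → - A ≡ A ℤ.+ - ℤ.1ℤ ℤ.* (+ 2 ℤ.* A)
  ring A = solve (A ∷ [])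

-- Residues modulo n

module _ {n : ℕ} {{_ : NonZero n}} where
  open ≡-Reasoning
  open Congruence (+ n)

  private
    pos-+* : ∀ x k → + (x + k * n) ≡ + x ℤ.+ + k ℤ.* + n
    pos-+* x k = trans (ℤ.pos-+ x (k * n)) (cong (ℤ._+_ (+ x)) (ℤ.pos-* k n))

  %-≡-mod : ∀ x → + (x % n) ≡ + x [mod + n ]
  %-≡-mod x = mod-sym (congruent (+ (x / n)) (begin
    + x                             ≡⟨ cong +_ (m≡m%n+[m/n]*n x n) ⟩
    + (x % n + x / n * n)           ≡⟨ pos-+* (x % n) (x / n) ⟩
    + (x % n) ℤ.+ + (x / n) ℤ.* + n ∎))

  %-≡⇒≡-mod : ∀ {x y} → x % n ≡ y % n → + x ≡ + y [mod + n ]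
  %-≡⇒≡-mod {x} {y} eq =
    mod-trans (mod-sym (%-≡-mod x)) (mod-trans (≡⇒≡-mod (cong +_ eq)) (%-≡-mod y))

  private
    %-≡-by-multiple : ∀ {x y} k → + x ≡ + y ℤ.+ + k ℤ.* + n → x % n ≡ y % n
    %-≡-by-multiple {x} {y} k eq = begin
      x % n           ≡⟨ cong (_% n) (ℤ.+-injective (trans eq (sym (pos-+* y k)))) ⟩
      (y + k * n) % n ≡⟨ [m+kn]%n≡m%n y k n ⟩
      y % n           ∎

  ≡-mod⇒%-≡ : ∀ {x y} → + x ≡ + y [mod + n ] → x % n ≡ y % n
  ≡-mod⇒%-≡ (congruent (+ k) eq) = %-≡-by-multiple k eq
  ≡-mod⇒%-≡ x≡y@(congruent -[1+ k ] _) =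
    sym (%-≡-by-multiple (suc k) (_≡_[mod_].equation (mod-sym x≡y)))

  %-cancel-+ˡ : ∀ z {x y} → (z + x) % n ≡ (z + y) % n → x % n ≡ y % n
  %-cancel-+ˡ z {x} {y} eq =
    ≡-mod⇒%-≡ (mod-cancelˡ (+ z)
      (subst₂ (λ u v → u ≡ v [mod + n ]) (ℤ.pos-+ z x) (ℤ.pos-+ z y) (%-≡⇒≡-mod eq)))

  [m+n%d]%d≡[m+n]%d : ∀ x y → (x + y % n) % n ≡ (x + y) % n
  [m+n%d]%d≡[m+n]%d x y = begin
    (x + y % n) % n         ≡⟨ %-distribˡ-+ x (y % n) n ⟩
    (x % n + y % n % n) % n ≡⟨ cong (λ t → (x % n + t) % n) (m%n%n≡m%n y n) ⟩
    (x % n + y % n) % n     ≡⟨ %-distribˡ-+ x y n ⟨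
    (x + y) % n             ∎

  %-cong-+ˡ : ∀ x {y z} → y % n ≡ z % n → (x + y) % n ≡ (x + z) % n
  %-cong-+ˡ x {y} {z} eq = begin
    (x + y) % n     ≡⟨ [m+n%d]%d≡[m+n]%d x y ⟨
    (x + y % n) % n ≡⟨ cong (λ t → (x + t) % n) eq ⟩
    (x + z % n) % n ≡⟨ [m+n%d]%d≡[m+n]%d x z ⟩
    (x + z) % n     ∎

  toℕ-mod : ∀ i → toℕ (i mod n) ≡ i % n
  toℕ-mod i = toℕ-fromℕ< (m%n<n i n)

  toℕ-%-injective : ∀ {u v : Fin n} → toℕ u % n ≡ toℕ v % n → u ≡ v
  toℕ-%-injective {u} {v} eq = toℕ-injective (begin
    toℕ u     ≡⟨ m<n⇒m%n≡m (toℕ<n u) ⟨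
    toℕ u % n ≡⟨ eq ⟩
    toℕ v % n ≡⟨ m<n⇒m%n≡m (toℕ<n v) ⟩
    toℕ v     ∎)

  mod-toℕ : ∀ (u : Fin n) → toℕ u mod n ≡ u
  mod-toℕ u = toℕ-%-injective (trans (cong (_% n) (toℕ-mod (toℕ u))) (m%n%n≡m%n (toℕ u) n))

  vertex : ℤ → Fin n
  vertex x = fromℕ< (n%ℕd<d x n)

  vertex-≡ : ∀ x → + toℕ (vertex x) ≡ x [mod + n ]
  vertex-≡ x = subst (λ r → + r ≡ x [mod + n ]) (sym (toℕ-fromℕ< (n%ℕd<d x n)))
    (mod-sym (congruent (x /ℕ n) (a≡a%ℕn+[a/ℕn]*n x n)))

  toℕ-mod-+ : ∀ i y → (toℕ (i mod n) + y) % n ≡ (i + y) % n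
  toℕ-mod-+ i y = begin
    (toℕ (i mod n) + y) % n ≡⟨ cong (λ t → (t + y) % n) (toℕ-mod i) ⟩
    (i % n + y) % n         ≡⟨ cong (_% n) (+-comm (i % n) y) ⟩
    (y + i % n) % n         ≡⟨ [m+n%d]%d≡[m+n]%d y i ⟩
    (y + i) % n             ≡⟨ cong (_% n) (+-comm y i) ⟩
    (i + y) % n             ∎

  mod-+-≢ : ∀ i {y} → 0 < y → y < n → i mod n ≢ (i + y) mod n
  mod-+-≢ i {y} 0<y y<n i≡i+y = n>0⇒n≢0 0<y (begin
    y                       ≡⟨ m<n⇒m%n≡m y<n ⟨
    y % n                   ≡⟨ %-cancel-+ˡ (toℕ (i mod n)) shifted ⟩
    0 % n                   ≡⟨ m<n⇒m%n≡m (>-nonZero⁻¹ n) ⟩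
    0                       ∎)
    where
    shifted : (toℕ (i mod n) + y) % n ≡ (toℕ (i mod n) + 0) % n
    shifted = begin
      (toℕ (i mod n) + y) % n ≡⟨ toℕ-mod-+ i y ⟩
      (i + y) % n             ≡⟨ m%n%n≡m%n (i + y) n ⟨
      (i + y) % n % n         ≡⟨ cong (_% n) (toℕ-mod (i + y)) ⟨
      toℕ ((i + y) mod n) % n ≡⟨ cong (λ u → toℕ u % n) i≡i+y ⟨
      toℕ (i mod n) % n       ≡⟨ cong (_% n) (+-identityʳ _) ⟨
      (toℕ (i mod n) + 0) % n ∎

  %-≡⇒mod-≡ : ∀ {i j} → i % n ≡ j % n → i mod n ≡ j mod n
  %-≡⇒mod-≡ {i} {j} eq = toℕ-injective (trans (toℕ-mod i) (trans eq (sym (toℕ-mod j))))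

  cost≡sum-mod : ∀ (f : Fin n → ℕ) → cost f ≡ sum (applyUpTo (λ i → f (i mod n)) n)
  cost≡sum-mod f = cong sum (begin
    map f (allFin n)                  ≡⟨ map-tabulate id f ⟩
    tabulate f                        ≡⟨ tabulate-cong (λ u → cong f (sym (mod-toℕ u))) ⟩
    tabulate (λ u → f (toℕ u mod n))  ≡⟨ tabulate-toℕ n (λ i → f (i mod n)) ⟩
    applyUpTo (λ i → f (i mod n)) n   ∎)

  offset : Fin n → Fin n → ℕ
  offset u v = (n ∸ toℕ u + toℕ v) % n

  offset<n : ∀ {u v} → offset u v < n
  offset<n = m%n<n _ n

  offset-shift : ∀ {u v} → (toℕ u + offset u v) % n ≡ toℕ v % n
  offset-shift {u} {v} = begin
    (toℕ u + (n ∸ toℕ u + toℕ v) % n) % n ≡⟨ [m+n%d]%d≡[m+n]%d (toℕ u) _ ⟩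
    (toℕ u + (n ∸ toℕ u + toℕ v)) % n     ≡⟨ cong (_% n) (+-assoc (toℕ u) _ _) ⟨
    (toℕ u + (n ∸ toℕ u) + toℕ v) % n     ≡⟨ cong (λ t → (t + toℕ v) % n) (m+[n∸m]≡n (<⇒≤ (toℕ<n u))) ⟩
    (n + toℕ v) % n                        ≡⟨ cong (_% n) (+-comm n (toℕ v)) ⟩
    (toℕ v + n) % n                        ≡⟨ [m+n]%n≡m%n (toℕ v) n ⟩
    toℕ v % n                              ∎

  offset-unique : ∀ {u v y} → y < n → (toℕ u + y) % n ≡ toℕ v % n → offset u v ≡ y
  offset-unique {u} {v} {y} y<n shifted = begin
    offset u v     ≡⟨ m<n⇒m%n≡m (offset<n {u} {v}) ⟨
    offset u v % n ≡⟨ %-cancel-+ˡ (toℕ u) (trans offset-shift (sym shifted)) ⟩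
    y % n          ≡⟨ m<n⇒m%n≡m y<n ⟩
    y              ∎

-- Distances and broadcasts in digraphs

module _ {n : ℕ} {G : Digraph n} where

  Dist-unique : ∀ {u v k l} → Dist G u v k → Dist G u v l → k ≡ l
  Dist-unique (walk-k , least-k) (walk-l , least-l) = ≤-antisym (least-k _ walk-l) (least-l _ walk-k)

  private
    Ecc-≤ : ∀ {v e f} → Ecc G v e → Ecc G v f → f ≤ e
    Ecc-≤ (within-e , _) (_ , w , dist-f) with within-e w
    ... | k , dist-k , k≤e = subst (_≤ _) (Dist-unique dist-k dist-f) k≤e

  Ecc-unique : ∀ {v e f} → Ecc G v e → Ecc G v f → e ≡ f
  Ecc-unique E F = ≤-antisym (Ecc-≤ F E) (Ecc-≤ E F)

  private
    Diam-≤ : ∀ {D E} → Diam G D → Diam G E → E ≤ D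
    Diam-≤ (within-D , _) (_ , v , ecc-E) with within-D v
    ... | e , ecc-e , e≤D = subst (_≤ _) (Ecc-unique ecc-e ecc-E) e≤D

  Diam-unique : ∀ {D E} → Diam G D → Diam G E → D ≡ E
  Diam-unique 𝔻 𝔼 = ≤-antisym (Diam-≤ 𝔼 𝔻) (Diam-≤ 𝔻 𝔼)

  walk-⊓ : ∀ {j k u v} → Walk G j u v → Walk G k u v → Walk G (j ⊓ k) u v
  walk-⊓ {j} {k} walk-j walk-k with ⊓-sel j k
  ... | inj₁ j⊓k≡j = subst (λ l → Walk G l _ _) (sym j⊓k≡j) walk-j
  ... | inj₂ j⊓k≡k = subst (λ l → Walk G l _ _) (sym j⊓k≡k) walk-k

atZero : ∀ {m} → ℕ → Fin (suc m) → ℕ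
atZero D fzero    = D
atZero D (fsuc _) = 0

cost-atZero : ∀ {m} D → cost (atZero {m} D) ≡ D
cost-atZero {m} D = begin
  D + sum (map (atZero {m} D) (tabulate fsuc))
    ≡⟨ cong (λ xs → D + sum xs) (map-tabulate {n = m} fsuc (atZero D)) ⟩
  D + sum (tabulate {n = m} (λ _ → 0))
    ≡⟨ cong (_+_ D) (sum-zeros m) ⟩
  D + 0
    ≡⟨ +-identityʳ D ⟩
  D ∎
  where
  open ≡-Reasoning
  sum-zeros : ∀ m → sum (tabulate {n = m} (λ _ → 0)) ≡ 0
  sum-zeros zero    = refl
  sum-zeros (suc m) = sum-zeros m

atZero-independent : ∀ {m} {G : Digraph (suc m)} {D} →
  Ecc G fzero D → Diam G D → IsIndepBroadcast G (atZero D)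
atZero-independent {D = D} ecc diam = below-diam , below-ecc , independent
  where
  atZero-≤ : ∀ v → atZero D v ≤ D
  atZero-≤ fzero    = ≤-refl
  atZero-≤ (fsuc _) = z≤n
  below-diam : ∀ E → Diam _ E → ∀ v → atZero D v ≤ E
  below-diam E diam′ v = subst (atZero D v ≤_) (Diam-unique diam diam′) (atZero-≤ v)
  below-ecc : ∀ v e → Ecc _ v e → atZero D v ≤ e
  below-ecc fzero    e ecc′ = ≤-reflexive (Ecc-unique ecc ecc′)
  below-ecc (fsuc _) e _    = z≤n
  independent : ∀ u v → u ≢ v → 0 < atZero D u → 0 < atZero D v →
    ∀ k → Dist _ u v k → atZero D u < k
  independent fzero fzero u≢v _ _ _ _ = contradiction refl u≢v

self-centred-broadcast : ∀ {n} {{_ : NonZero n}} {G : Digraph n} {D} →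
  (∀ v → Ecc G v D) → Diam G D → ∃[ f ] (IsIndepBroadcast G f × cost f ≡ D)
self-centred-broadcast {suc m} {D = D} ecc diam = atZero D , atZero-independent (ecc fzero) diam , cost-atZero {m} D

-- Walks in circulant digraphs

module _ (b c : ℤ) where

  displacement : ℕ → ℕ → ℤ
  displacement p q = + p ℤ.* b ℤ.+ + q ℤ.* c

  displacement-sucˡ : ∀ p q → displacement (suc p) q ≡ b ℤ.+ displacement p q
  displacement-sucˡ p q = ring (+ p) (+ q)
    where
    ring : ∀ P Q → (+ 1 ℤ.+ P) ℤ.* b ℤ.+ Q ℤ.* c ≡ b ℤ.+ (P ℤ.* b ℤ.+ Q ℤ.* c)
    ring P Q = solve (P ∷ Q ∷ b ∷ c ∷ [])

  displacement-sucʳ : ∀ p q → displacement p (suc q) ≡ c ℤ.+ displacement p q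
  displacement-sucʳ p q = ring (+ p) (+ q)
    where
    ring : ∀ P Q → P ℤ.* b ℤ.+ (+ 1 ℤ.+ Q) ℤ.* c ≡ c ℤ.+ (P ℤ.* b ℤ.+ Q ℤ.* c)
    ring P Q = solve (P ∷ Q ∷ b ∷ c ∷ [])

module _ {n : ℕ} {{_ : NonZero n}} (b c : ℤ) where
  open Congruence (+ n)

  private
    _⟶_by_ : Fin n → Fin n → ℤ → Set
    u ⟶ v by d = + toℕ v ≡ + toℕ u ℤ.+ d [mod + n ]

  walk⇒displacement : ∀ {j u v} → Walk (CircArc n (b ∷ c ∷ [])) j u v →
    ∃[ p ] ∃[ q ] (p + q ≡ j × u ⟶ v by displacement b c p q)
  walk⇒displacement {u = u} nil = 0 , 0 , refl , ≡⇒≡-mod (sym (ℤ.+-identityʳ (+ toℕ u)))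
  walk⇒displacement {u = u} {v} (cons (here (k , arc)) walk) with walk⇒displacement walk
  ... | p , q , refl , v≡ = suc p , q , refl ,
    subst (u ⟶ v by_) (sym (displacement-sucˡ b c p q))
      (mod-compose {y = + toℕ u} {s = b} {d = displacement b c p q} (congruent k arc) v≡)
  walk⇒displacement {u = u} {v} (cons (there (here (k , arc))) walk) with walk⇒displacement walk
  ... | p , q , refl , v≡ = p , suc q , +-suc p q ,
    subst (u ⟶ v by_) (sym (displacement-sucʳ b c p q))
      (mod-compose {y = + toℕ u} {s = c} {d = displacement b c p q} (congruent k arc) v≡)

  displacement⇒walk : ∀ p q {u v} → u ⟶ v by displacement b c p q →
    Walk (CircArc n (b ∷ c ∷ [])) (p + q) u v
  displacement⇒walk zero zero {u} {v} v≡ =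
    subst (Walk _ 0 u) (toℕ-%-injective (≡-mod⇒%-≡ v≡u)) nil
    where
    v≡u : + toℕ u ≡ + toℕ v [mod + n ]
    v≡u = mod-sym (mod-trans v≡ (≡⇒≡-mod (ℤ.+-identityʳ (+ toℕ u))))
  displacement⇒walk (suc p) q {u} {v} v≡ = cons (here (quotient , equation)) (displacement⇒walk p q
    (mod-decompose {y = + toℕ u} {s = b} {d = displacement b c p q} (vertex-≡ _)
      (subst (u ⟶ v by_) (displacement-sucˡ b c p q) v≡)))
    where open _≡_[mod_] (vertex-≡ (+ toℕ u ℤ.+ b))
  displacement⇒walk zero (suc q) {u} {v} v≡ = cons (there (here (quotient , equation))) (displacement⇒walk 0 q
    (mod-decompose {y = + toℕ u} {s = c} {d = displacement b c 0 q} (vertex-≡ _)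
      (subst (u ⟶ v by_) (displacement-sucʳ b c 0 q) v≡)))
    where open _≡_[mod_] (vertex-≡ (+ toℕ u ℤ.+ c))

-- The circulant digraph C(2a; 1, c) with c ≡ a (mod 2a)

module Circulant (a : ℕ) {{_ : NonZero a}} (c : ℤ) (c≡a : c ≡ + a [mod + (2 * a) ]) where

  n : ℕ
  n = 2 * a

  instance
    n≢0 : NonZero n
    n≢0 = m*n≢0 2 a

  open Congruence (+ n)

  n≡a+a : n ≡ a + a
  n≡a+a = cong (_+_ a) (+-identityʳ a)

  a<n : a < n
  a<n = subst (a <_) (sym n≡a+a) (m<m+n a (>-nonZero⁻¹ a))

  pred[a]<a : pred a < a
  pred[a]<a = subst (pred a <_) (suc-pred a) (n<1+n (pred a))

  G : Digraph n
  G = CircArc n (+ 1 ∷ c ∷ [])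

  private
    displacement≡ : ∀ p q → displacement (+ 1) c p q ≡ + (p + q * a) [mod + n ]
    displacement≡ p q = mod-trans
      (mod-+ (≡⇒≡-mod (ℤ.*-identityʳ (+ p))) (mod-*ˡ (+ q) c≡a))
      (≡⇒≡-mod (sym (trans (ℤ.pos-+ p (q * a)) (cong (ℤ._+_ (+ p)) (ℤ.pos-* q a)))))

    shift≡ : ∀ (u : Fin n) p q →
      + toℕ u ℤ.+ displacement (+ 1) c p q ≡ + (toℕ u + (p + q * a)) [mod + n ]
    shift≡ u p q =
      mod-trans (mod-+ (mod-refl {+ toℕ u}) (displacement≡ p q)) (≡⇒≡-mod (sym (ℤ.pos-+ (toℕ u) _)))

  walk⇒steps : ∀ {j u v} → Walk G j u v →
    ∃[ p ] ∃[ q ] (p + q ≡ j × (toℕ u + (p + q * a)) % n ≡ toℕ v % n)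
  walk⇒steps {u = u} walk with walk⇒displacement {n = n} (+ 1) c walk
  ... | p , q , p+q≡j , v≡ = p , q , p+q≡j , sym (≡-mod⇒%-≡ {n = n} (mod-trans v≡ (shift≡ u p q)))

  steps⇒walk : ∀ p q {u v} → (toℕ u + (p + q * a)) % n ≡ toℕ v % n → Walk G (p + q) u v
  steps⇒walk p q {u} v≡ =
    displacement⇒walk {n = n} (+ 1) c p q (mod-sym (mod-trans (shift≡ u p q) (%-≡⇒≡-mod {n = n} v≡)))

  [[x+a]%n+a]%n≡x%n : ∀ x → ((x + a) % n + a) % n ≡ x % n
  [[x+a]%n+a]%n≡x%n x = begin
    ((x + a) % n + a) % n ≡⟨ cong (_% n) (+-comm _ a) ⟩
    (a + (x + a) % n) % n ≡⟨ [m+n%d]%d≡[m+n]%d a (x + a) ⟩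
    (a + (x + a)) % n     ≡⟨ cong (_% n) (ℕ-Ring.solve (a ∷ x ∷ [])) ⟩
    (x + 2 * a) % n       ≡⟨ [m+n]%n≡m%n x n ⟩
    x % n                 ∎
    where open ≡-Reasoning

  -- The length of a shortest walk covering the offset x: either x unit arcs, or one
  -- arc of length a followed by (x + a) mod n unit arcs.
  circDist : ℕ → ℕ
  circDist x = x ⊓ suc ((x + a) % n)

  circDist-least : ∀ p q → circDist ((p + q * a) % n) ≤ p + q
  circDist-least p zero             = ≤-trans (m⊓n≤m _ _) (m%n≤m (p + 0) n)
  circDist-least p (suc zero)       = ≤-trans (m⊓n≤n _ _) (begin
    suc (((p + 1 * a) % n + a) % n) ≡⟨ cong (λ t → suc (((p + t) % n + a) % n)) (*-identityˡ a) ⟩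
    suc (((p + a) % n + a) % n)     ≡⟨ cong suc ([[x+a]%n+a]%n≡x%n p) ⟩
    suc (p % n)                     ≤⟨ s≤s (m%n≤m p n) ⟩
    suc p                           ≡⟨ +-comm 1 p ⟩
    p + 1                           ∎)
    where open ≤-Reasoning
  circDist-least p (suc (suc q)) = begin
    circDist ((p + suc (suc q) * a) % n) ≡⟨ cong (λ t → circDist (t % n)) (ℕ-Ring.solve (p ∷ q ∷ a ∷ [])) ⟩
    circDist ((p + q * a + 2 * a) % n)   ≡⟨ cong circDist ([m+n]%n≡m%n (p + q * a) n) ⟩
    circDist ((p + q * a) % n)           ≤⟨ circDist-least p q ⟩
    p + q                                ≤⟨ +-monoʳ-≤ p (m≤n⇒m≤1+n (n≤1+n q)) ⟩
    p + suc (suc q)                      ∎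
    where open ≤-Reasoning

  circDist-a+ : ∀ {t} → t < a → circDist (a + t) ≡ (a + t) ⊓ suc t
  circDist-a+ {t} t<a = cong (λ r → (a + t) ⊓ suc r) (begin
    (a + t + a) % n   ≡⟨ cong (_% n) (ℕ-Ring.solve (a ∷ t ∷ [])) ⟩
    (t + 2 * a) % n   ≡⟨ [m+n]%n≡m%n t n ⟩
    t % n             ≡⟨ m<n⇒m%n≡m (<-≤-trans t<a (m≤m+n a (a + 0))) ⟩
    t                 ∎)
    where open ≡-Reasoning

  circDist≤a : ∀ {x} → x < n → circDist x ≤ a
  circDist≤a {x} x<n with x ≤? a
  ... | yes x≤a = ≤-trans (m⊓n≤m x _) x≤a
  ... | no  x≰a = begin
    circDist x       ≡⟨ cong circDist a+t≡x ⟨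
    circDist (a + t) ≡⟨ circDist-a+ t<a ⟩
    (a + t) ⊓ suc t  ≤⟨ m⊓n≤n _ _ ⟩
    suc t            ≤⟨ t<a ⟩
    a                ∎
    where
    open ≤-Reasoning
    t : ℕ
    t = x ∸ a
    a+t≡x : a + t ≡ x
    a+t≡x = m+[n∸m]≡n (<⇒≤ (≰⇒> x≰a))
    t<a : t < a
    t<a = +-cancelˡ-< a t a (subst₂ _<_ (sym a+t≡x) n≡a+a x<n)

  circDist-max : circDist (a + pred a) ≡ a
  circDist-max = begin
    circDist (a + pred a)       ≡⟨ circDist-a+ pred[a]<a ⟩
    (a + pred a) ⊓ suc (pred a) ≡⟨ cong (_⊓_ (a + pred a)) (suc-pred a) ⟩
    (a + pred a) ⊓ a            ≡⟨ m≥n⇒m⊓n≡n (m≤m+n a (pred a)) ⟩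
    a                           ∎
    where open ≡-Reasoning

  dist≡circDist : ∀ u v → Dist G u v (circDist (offset u v))
  dist≡circDist u v = walk-⊓ by-units by-jump , least
    where
    x r : ℕ
    x = offset u v
    r = (x + a) % n

    by-units : Walk G x u v
    by-units = subst (λ l → Walk G l u v) (+-identityʳ x)
      (steps⇒walk x 0 (trans (cong (λ y → (toℕ u + y) % n) (+-identityʳ x)) (offset-shift {u = u} {v = v})))

    by-jump : Walk G (suc r) u v
    by-jump = subst (λ l → Walk G l u v) (+-comm r 1)
      (steps⇒walk r 1 (trans (%-cong-+ˡ (toℕ u) r+a≡x) (offset-shift {u = u} {v = v})))
      where
      r+a≡x : (r + 1 * a) % n ≡ x % n
      r+a≡x = trans (cong (λ t → (r + t) % n) (*-identityˡ a)) ([[x+a]%n+a]%n≡x%n x)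

    least : ∀ j → Walk G j u v → circDist x ≤ j
    least j walk = from-steps (walk⇒steps walk)
      where
      from-steps : ∃[ p ] ∃[ q ] (p + q ≡ j × (toℕ u + (p + q * a)) % n ≡ toℕ v % n) → circDist x ≤ j
      from-steps (p , q , p+q≡j , v≡) =
        subst₂ (λ y l → circDist y ≤ l) steps≡x p+q≡j (circDist-least p q)
        where
        steps≡x : (p + q * a) % n ≡ x
        steps≡x = trans (%-cancel-+ˡ (toℕ u) (trans v≡ (sym (offset-shift {u = u} {v = v}))))
                        (m<n⇒m%n≡m (offset<n {u = u} {v = v}))

  ecc≡a : ∀ v → Ecc G v a
  ecc≡a v = (λ u → circDist (offset v u) , dist≡circDist v u , circDist≤a (offset<n {u = v} {v = u})) ,
          far , subst (Dist G v far) far-dist (dist≡circDist v far)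
    where
    far : Fin n
    far = (toℕ v + (a + pred a)) mod n
    far-offset : offset v far ≡ a + pred a
    far-offset = offset-unique {u = v} {v = far}
      (subst (a + pred a <_) (sym n≡a+a) (+-monoʳ-< a pred[a]<a))
      (sym (trans (cong (_% n) (toℕ-mod (toℕ v + (a + pred a)))) (m%n%n≡m%n _ n)))
    far-dist : circDist (offset v far) ≡ a
    far-dist = trans (cong circDist far-offset) circDist-max

  diam≡a : Diam G a
  diam≡a = (λ v → a , ecc≡a v , ≤-refl) , 0 mod n , ecc≡a (0 mod n)

  module _ {f : Fin n → ℕ} (independent : IsIndepBroadcast G f) where

    below-walk : ∀ {u v k} → u ≢ v → 0 < f u → 0 < f v → Walk G k u v → f u < k
    below-walk {u} {v} u≢v 0<fu 0<fv walk =
      <-≤-trans (proj₂ (proj₂ independent) u v u≢v 0<fu 0<fv _ (dist≡circDist u v))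
                (proj₂ (dist≡circDist u v) _ walk)

    private
      P : ℕ → ℕ
      P i = f (i mod n)

      H : ℕ → ℕ
      H r = P r + P (a + r)

      P≤a : ∀ i → P i ≤ a
      P≤a i = proj₁ (proj₂ independent) (i mod n) a (ecc≡a (i mod n))

      P-periodic : ∀ {i j} → i ≡ j + n → P i ≡ P j
      P-periodic {i} {j} i≡j+n = cong f (%-≡⇒mod-≡ (trans (cong (_% n) i≡j+n) ([m+n]%n≡m%n j n)))

      ≡0-unless : ∀ {m} → ¬ 0 < m → m ≡ 0
      ≡0-unless ¬0<m = n≤0⇒n≡0 (≮⇒≥ ¬0<m)

      P-silent : ∀ i {y} p q → y ≡ p + q * a → 0 < y → y < n →
        0 < P i → p + q ≤ P i → P (i + y) ≡ 0
      P-silent i {y} p q y≡ 0<y y<n 0<Pi p+q≤Pi = ≡0-unless λ 0<Pi+y →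
        <⇒≱ (below-walk (mod-+-≢ i 0<y y<n) 0<Pi 0<Pi+y (steps⇒walk p q steps)) p+q≤Pi
        where
        open ≡-Reasoning
        steps : (toℕ (i mod n) + (p + q * a)) % n ≡ toℕ ((i + y) mod n) % n
        steps = begin
          (toℕ (i mod n) + (p + q * a)) % n ≡⟨ cong (λ t → (toℕ (i mod n) + t) % n) y≡ ⟨
          (toℕ (i mod n) + y) % n           ≡⟨ toℕ-mod-+ i y ⟩
          (i + y) % n                       ≡⟨ m%n%n≡m%n (i + y) n ⟨
          (i + y) % n % n                   ≡⟨ cong (_% n) (toℕ-mod (i + y)) ⟨
          toℕ ((i + y) mod n) % n           ∎

      P-exclusive : ∀ i → 0 < P i → P (i + a) ≡ 0
      P-exclusive i 0<Pi = P-silent i 0 1 (sym (*-identityˡ a)) (>-nonZero⁻¹ a) a<n 0<Pi 0<Pi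

      P-gap : ∀ i j → 0 < j → j < P i → P (i + j) ≡ 0 × P (i + (j + a)) ≡ 0
      P-gap i j 0<j j<Pi =
        P-silent i j 0 (sym (+-identityʳ j)) 0<j (<-trans j<a a<n) 0<Pi
          (subst (_≤ P i) (sym (+-identityʳ j)) (<⇒≤ j<Pi)) ,
        P-silent i j 1 (cong (_+_ j) (sym (*-identityˡ a))) 0<j+a j+a<n 0<Pi
          (subst (_≤ P i) (+-comm 1 j) j<Pi)
        where
        0<Pi : 0 < P i
        0<Pi = <-trans 0<j j<Pi
        j<a : j < a
        j<a = <-≤-trans j<Pi (P≤a i)
        0<j+a : 0 < j + a
        0<j+a = ≤-trans 0<j (m≤m+n j a)
        j+a<n : j + a < n
        j+a<n = subst (j + a <_) (sym n≡a+a) (+-monoˡ-< a j<a)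

      H-periodic : Periodic a H
      H-periodic r = begin
        P (r + a) + P (a + (r + a)) ≡⟨ cong₂ _+_ (cong P (+-comm r a)) (P-periodic shift) ⟩
        P (a + r) + P r             ≡⟨ +-comm (P (a + r)) (P r) ⟩
        P r + P (a + r)             ∎
        where
        open ≡-Reasoning
        shift : a + (r + a) ≡ r + 2 * a
        shift = ℕ-Ring.solve (a ∷ r ∷ [])

      H-gapped : Gapped H
      H-gapped r j 0<j j<Hr with 0 <? P r
      ... | yes 0<Pr = cong₂ _+_ (proj₁ gap) (trans (cong P shift) (proj₂ gap))
        where
        Pa+r≡0 : P (a + r) ≡ 0
        Pa+r≡0 = trans (cong P (+-comm a r)) (P-exclusive r 0<Pr)
        gap : P (r + j) ≡ 0 × P (r + (j + a)) ≡ 0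
        gap = P-gap r j 0<j (subst (j <_) (trans (cong (_+_ (P r)) Pa+r≡0) (+-identityʳ (P r))) j<Hr)
        shift : a + (r + j) ≡ r + (j + a)
        shift = ℕ-Ring.solve (a ∷ r ∷ j ∷ [])
      ... | no ¬0<Pr =
        cong₂ _+_ (trans (sym (P-periodic shift)) (proj₂ gap))
                  (trans (cong P (sym (+-assoc a r j))) (proj₁ gap))
        where
        gap : P (a + r + j) ≡ 0 × P (a + r + (j + a)) ≡ 0
        gap = P-gap (a + r) j 0<j (subst (λ t → j < t + P (a + r)) (≡0-unless ¬0<Pr) j<Hr)
        shift : a + r + (j + a) ≡ r + j + 2 * a
        shift = ℕ-Ring.solve (a ∷ r ∷ j ∷ [])

    cost≤a : cost f ≤ a
    cost≤a = begin
      cost f                                                    ≡⟨ cost≡sum-mod f ⟩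
      sum (applyUpTo P n)                                       ≡⟨ cong (sum ∘ applyUpTo P) n≡a+a ⟩
      sum (applyUpTo P (a + a))                                 ≡⟨ sum-applyUpTo-+ P a a ⟩
      sum (applyUpTo P a) + sum (applyUpTo (λ r → P (a + r)) a) ≡⟨ sum-applyUpTo-distrib P (λ r → P (a + r)) a ⟨
      sum (applyUpTo H a)                                       ≤⟨ sum-periodic-gapped-≤ a H-periodic H-gapped ⟩
      a                                                         ∎
      where open ≤-Reasoning

  β≡a : BroadcastIndepNumber G a
  β≡a = self-centred-broadcast ecc≡a diam≡a , λ _ independent → cost≤a independent

theorem3 : ∀ (a : ℕ) → 2 ≤ a →
    BroadcastIndepNumber (CircArc (2 * a) (+ 1 ∷ + a ∷ [])) a ×
    BroadcastIndepNumber (CircArc (2 * a) (+ 1 ∷ - (+ a) ∷ [])) a ×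
    Diam (CircArc (2 * a) (+ 1 ∷ + a ∷ [])) a
theorem3 a@(suc _) _ =
  Circulant.β≡a a (+ a) (Congruence.mod-refl _) ,
  Circulant.β≡a a (- (+ a)) (-a≡a[mod2a] a) ,
  Circulant.diam≡a a (+ a) (Congruence.mod-refl _)
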